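{- Let $p$ be a string of length $m$, let $h=\lfloor m/3\rfloor$, and let $W$ be a string of length $m+h$ written as $W=q'\,q\,q''$ with $|q'|=h$, $|q|=m-h$ and $|q''|=h$. Suppose $q$ occurs at least twice in $p$. Let $g$ be the length of the shortest period of $q$ and write $q=(uv)^t u$ with $|uv|=g$, $|v|\ge 1$ and $t\ge 2$. Let $i'$ be the largest integer such that $(uv)^{i'}$ is a suffix of $q'$, and let $i''$ be the largest integer such that $(vu)^{i''}$ is a prefix of $q''$. Then the number of occurrences of $q$ in $W$ is exactly $i'+i''+1$.
   Context: A period of a string $x$ is a positive integer $r$ such that $x[j]=x[j+r]$ for all valid $j$; the shortest period is the least such $r$. For a string $z$, $z^k$ denotes $z$ concatenated $k$ times. Occurrences are counted by starting position and may overlap. -}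

module Defs where

open import Data.Nat using (ℕ; zero; suc; _+_; _<_; _≤_)
open import Data.List using (List; []; _∷_; _++_; length; take; drop; filter; upTo)
open import Data.List.Properties using (≡-dec)
open import Data.Maybe using (Maybe; just; nothing)
open import Data.Product using (∃; _×_)
open import Relation.Binary.Definitions using (DecidableEquality)
open import Relation.Binary.PropositionalEquality using (_≡_)

module _ {A : Set} where

  at : List A → ℕ → Maybe A
  at []       _       = nothing
  at (x ∷ xs) zero    = just x
  at (x ∷ xs) (suc j) = at xs j

  IsPeriod : ℕ → List A → Set
  IsPeriod r x = (0 < r) × (∀ j → j + r < length x → at x j ≡ at x (j + r))

  IsShortestPeriod : ℕ → List A → Set
  IsShortestPeriod g x = IsPeriod g x × (∀ r → IsPeriod r x → g ≤ r)

  pow : List A → ℕ → List A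
  pow z zero    = []
  pow z (suc k) = z ++ pow z k

  IsSuffix : List A → List A → Set
  IsSuffix s x = ∃ λ y → y ++ s ≡ x

  IsPrefix : List A → List A → Set
  IsPrefix s x = ∃ λ y → s ++ y ≡ x

  OccursAt : List A → List A → ℕ → Set
  OccursAt q w k = (k + length q ≤ length w) × (take (length q) (drop k w) ≡ q)

  -- number of starting positions k (0 ≤ k ≤ |w| - |q|) at which q occurs in w
  countOcc : DecidableEquality A → List A → List A → ℕ
  countOcc _≟_ q w =
    length (filter (λ k → ≡-dec _≟_ (take (length q) (drop k w)) q)
                   (upTo (suc (length w))))

-- Every occurrence of q in W = q′ q q″ lies within h of the central one, at position h, so its
-- shift e from the centre is a period of q with e + g ≤ |q|. The difference of two such periods
-- is again a period, so the shortest period g divides e. Since q (vu)^c = (uv)^c q, the position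
-- h − c g is an occurrence iff (uv)^c is a suffix of q′, and h + c g iff (vu)^c is a prefix of q″;
-- by maximality of i′ and i″ the occurrences therefore form the arithmetic progression
-- h − i′ g, …, h + i″ g of i′ + i″ + 1 terms. The two occurrences of q in p only serve to give g ≤ h.
module Submission where

open import Defs
open import Data.Nat
open import Data.Nat.Properties
open import Data.Nat.DivMod using (_/_; m/n*n≤m; m/n≤m)
open import Data.Nat.Divisibility using (_∣_; divides; _∣0; ∣-refl; ∣m∣n⇒∣m+n)
open import Data.Nat.Induction using (<-rec)
open import Data.List using (List; []; _∷_; _++_; length; take; drop; filter; upTo; applyUpTo)
open import Data.List.Properties
  using ( ++-assoc; ++-identityʳ; ++-cancelˡ; length-++; length-take; length-drop; take++drop≡id
        ; take-take; take-[]; drop-drop; length-applyUpTo; ≡-dec )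
open import Data.List.Membership.Propositional using (_∈_)
open import Data.List.Membership.Propositional.Properties
  using (∈-filter⁺; ∈-filter⁻; ∈-upTo⁺; ∈-applyUpTo⁺; ∈-applyUpTo⁻)
open import Data.List.Membership.Propositional.Properties.WithK using (unique∧set⇒bag)
open import Data.List.Relation.Unary.Unique.Propositional.Properties using (filter⁺; upTo⁺; applyUpTo⁺₁)
open import Data.List.Relation.Binary.BagAndSetEquality using (∼bag⇒↭)
open import Data.List.Relation.Binary.Permutation.Propositional.Properties using (↭-length)
open import Data.Product using (∃-syntax; _×_; _,_; proj₁; proj₂)
open import Data.Sum as Sum using (_⊎_; inj₁; inj₂)
open import Function.Base using (_∘_)
open import Function.Bundles using (_⇔_; mk⇔; Equivalence)
open import Function.Construct.Composition using (_⇔-∘_)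
open import Relation.Binary.Definitions using (DecidableEquality)
open import Relation.Binary.PropositionalEquality
open import Relation.Nullary using (¬_; yes; no; contradiction)
open import Relation.Unary using (Pred; Decidable)

Progression : (a g n k : ℕ) → Set
Progression a g n k = ∃[ j ] j ≤ n × k ≡ a + j * g

TwoSided : (g h i′ i″ k : ℕ) → Set
TwoSided g h i′ i″ k = (∃[ c ] c ≤ i′ × k + c * g ≡ h) ⊎ (∃[ c ] c ≤ i″ × k ≡ h + c * g)

two-sided⇔progression : ∀ {a g h i′ i″} k → a + i′ * g ≡ h → TwoSided g h i′ i″ k ⇔ Progression a g (i′ + i″) k
two-sided⇔progression {a} {g} {h} {i′} {i″} k a+i′g≡h = mk⇔ to from
  where
  open ≡-Reasoning
  step : ∀ i c → a + i * g + c * g ≡ a + (i + c) * g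
  step i c = trans (+-assoc a (i * g) (c * g)) (cong (a +_) (sym (*-distribʳ-+ g i c)))
  to : TwoSided g h i′ i″ k → Progression a g (i′ + i″) k
  to (inj₁ (c , c≤i′ , k+cg≡h)) with d , c+d≡i′ ← m≤n⇒∃[o]m+o≡n c≤i′ =
    d , ≤-trans (m+n≤o⇒n≤o c (≤-reflexive c+d≡i′)) (m≤m+n i′ i″) , +-cancelʳ-≡ (c * g) k (a + d * g) (begin
      k + c * g          ≡⟨ k+cg≡h ⟩
      h                  ≡⟨ a+i′g≡h ⟨
      a + i′ * g         ≡⟨ cong (λ i → a + i * g) (trans (sym c+d≡i′) (+-comm c d)) ⟩
      a + (d + c) * g    ≡⟨ step d c ⟨
      a + d * g + c * g  ∎)
  to (inj₂ (c , c≤i″ , refl)) = i′ + c , +-monoʳ-≤ i′ c≤i″ , trans (cong (_+ c * g) (sym a+i′g≡h)) (step i′ c)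
  from : Progression a g (i′ + i″) k → TwoSided g h i′ i″ k
  from (j , j≤ , refl) with j ≤? i′
  ... | yes j≤i′ with d , j+d≡i′ ← m≤n⇒∃[o]m+o≡n j≤i′ =
    inj₁ (d , m+n≤o⇒n≤o j (≤-reflexive j+d≡i′) , trans (step j d) (trans (cong (λ i → a + i * g) j+d≡i′) a+i′g≡h))
  ... | no j≰i′ with c , refl ← m≤n⇒∃[o]m+o≡n (<⇒≤ (≰⇒> j≰i′)) =
    inj₂ (c , +-cancelˡ-≤ i′ c i″ j≤ , trans (sym (step i′ c)) (cong (_+ c * g) a+i′g≡h))

-- The filtered list and the progression are duplicate-free lists with the same members.
length-filter-upTo-progression :
  ∀ {ℓ} {P : Pred ℕ ℓ} (P? : Decidable P) (a g n N : ℕ) .{{_ : NonZero g}} →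
  (∀ k → P k ⇔ Progression a g n k) → a + n * g < N → length (filter P? (upTo N)) ≡ suc n
length-filter-upTo-progression P? a g n N P⇔ last<N = begin
  length (filter P? (upTo N))
    ≡⟨ ↭-length (∼bag⇒↭ (unique∧set⇒bag (filter⁺ P? (upTo⁺ N)) (applyUpTo⁺₁ term (suc n) term-<)
                                         (mk⇔ to from))) ⟩
  length (applyUpTo term (suc n))
    ≡⟨ length-applyUpTo term (suc n) ⟩
  suc n ∎
  where
  open ≡-Reasoning
  term : ℕ → ℕ
  term j = a + j * g
  term-< : ∀ {i j} → i < j → j < suc n → term i ≢ term j
  term-< i<j _ = <⇒≢ (+-monoʳ-< a (*-monoˡ-< g i<j))
  to : ∀ {k} → k ∈ filter P? (upTo N) → k ∈ applyUpTo term (suc n)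
  to {k} k∈ with j , j≤n , refl ← Equivalence.to (P⇔ k) (proj₂ (∈-filter⁻ P? {xs = upTo N} k∈)) =
    ∈-applyUpTo⁺ term (s≤s j≤n)
  from : ∀ {k} → k ∈ applyUpTo term (suc n) → k ∈ filter P? (upTo N)
  from k∈ with j , s≤s j≤n , refl ← ∈-applyUpTo⁻ term k∈ =
    ∈-filter⁺ P? (∈-upTo⁺ (≤-<-trans (+-monoʳ-≤ a (*-monoˡ-≤ g j≤n)) last<N))
                 (Equivalence.from (P⇔ _) (j , j≤n , refl))

module _ {A : Set} where

  take-length-++ : (xs ys : List A) → take (length xs) (xs ++ ys) ≡ xs
  take-length-++ []       ys = refl
  take-length-++ (x ∷ xs) ys = cong (x ∷_) (take-length-++ xs ys)

  drop-length-++ : (xs ys : List A) → drop (length xs) (xs ++ ys) ≡ ys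
  drop-length-++ []       ys = refl
  drop-length-++ (x ∷ xs) ys = drop-length-++ xs ys

  take-length+-++ : ∀ n (xs ys : List A) → take (length xs + n) (xs ++ ys) ≡ xs ++ take n ys
  take-length+-++ n []       ys = refl
  take-length+-++ n (x ∷ xs) ys = cong (x ∷_) (take-length+-++ n xs ys)

  take-++ˡ : ∀ n (xs ys : List A) → n ≤ length xs → take n (xs ++ ys) ≡ take n xs
  take-++ˡ zero    xs       ys _         = refl
  take-++ˡ (suc n) (x ∷ xs) ys (s≤s n≤) = cong (x ∷_) (take-++ˡ n xs ys n≤)

  drop-++ˡ : ∀ n (xs ys : List A) → n ≤ length xs → drop n (xs ++ ys) ≡ drop n xs ++ ys
  drop-++ˡ zero    xs       ys _         = refl
  drop-++ˡ (suc n) (x ∷ xs) ys (s≤s n≤) = drop-++ˡ n xs ys n≤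

  take-+ : ∀ m n (xs : List A) → take (m + n) xs ≡ take m xs ++ take n (drop m xs)
  take-+ zero    n xs       = refl
  take-+ (suc m) n []       = sym (take-[] n)
  take-+ (suc m) n (x ∷ xs) = cong (x ∷_) (take-+ m n xs)

  take-prefix : ∀ {m n} → m ≤ n → (xs : List A) → take m (take n xs) ≡ take m xs
  take-prefix {m} {n} m≤n xs = trans (take-take m n xs) (cong (λ i → take i xs) (m≤n⇒m⊓n≡m m≤n))

  conjugate⇒take : ∀ {x s s′ : List A} → x ++ s′ ≡ s ++ x → length s ≤ length x → take (length s) x ≡ s
  conjugate⇒take {x} {s} {s′} x++s′≡s++x s≤x = begin
    take (length s) x          ≡⟨ take-++ˡ (length s) x s′ s≤x ⟨
    take (length s) (x ++ s′)  ≡⟨ cong (take (length s)) x++s′≡s++x ⟩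
    take (length s) (s ++ x)   ≡⟨ take-length-++ s x ⟩
    s                          ∎
    where open ≡-Reasoning

  at-take : ∀ n (xs : List A) j → j < n → at (take n xs) j ≡ at xs j
  at-take (suc n) []       j       _         = refl
  at-take (suc n) (x ∷ xs) zero    _         = refl
  at-take (suc n) (x ∷ xs) (suc j) (s≤s j<n) = at-take n xs j j<n

  at-drop : ∀ k (xs : List A) j → at (drop k xs) j ≡ at xs (k + j)
  at-drop zero    xs       j = refl
  at-drop (suc k) []       j = refl
  at-drop (suc k) (x ∷ xs) j = at-drop k xs j

  pow-+ : ∀ (z : List A) m n → pow z (m + n) ≡ pow z m ++ pow z n
  pow-+ z zero    n = refl
  pow-+ z (suc m) n = trans (cong (z ++_) (pow-+ z m n)) (sym (++-assoc z (pow z m) (pow z n)))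

  pow-comm : ∀ (z : List A) m n → pow z m ++ pow z n ≡ pow z n ++ pow z m
  pow-comm z m n = trans (sym (pow-+ z m n)) (trans (cong (pow z) (+-comm m n)) (pow-+ z n m))

  length-pow : ∀ (z : List A) n → length (pow z n) ≡ n * length z
  length-pow z zero    = refl
  length-pow z (suc n) = trans (length-++ z) (cong (length z +_) (length-pow z n))

  pow-rotate : ∀ (u v : List A) n → pow (u ++ v) n ++ u ≡ u ++ pow (v ++ u) n
  pow-rotate u v zero    = sym (++-identityʳ u)
  pow-rotate u v (suc n) = begin
    ((u ++ v) ++ pow (u ++ v) n) ++ u  ≡⟨ ++-assoc (u ++ v) (pow (u ++ v) n) u ⟩
    (u ++ v) ++ (pow (u ++ v) n ++ u)  ≡⟨ cong ((u ++ v) ++_) (pow-rotate u v n) ⟩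
    (u ++ v) ++ (u ++ pow (v ++ u) n)  ≡⟨ ++-assoc u v _ ⟩
    u ++ (v ++ (u ++ pow (v ++ u) n))  ≡⟨ cong (u ++_) (++-assoc v u _) ⟨
    u ++ ((v ++ u) ++ pow (v ++ u) n)  ∎
    where open ≡-Reasoning

  pow-conjugate : ∀ (u v : List A) t c →
    (pow (u ++ v) t ++ u) ++ pow (v ++ u) c ≡ pow (u ++ v) c ++ (pow (u ++ v) t ++ u)
  pow-conjugate u v t c = begin
    (pow uv t ++ u) ++ pow (v ++ u) c  ≡⟨ ++-assoc (pow uv t) u _ ⟩
    pow uv t ++ (u ++ pow (v ++ u) c)  ≡⟨ cong (pow uv t ++_) (pow-rotate u v c) ⟨
    pow uv t ++ (pow uv c ++ u)        ≡⟨ ++-assoc (pow uv t) (pow uv c) u ⟨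
    (pow uv t ++ pow uv c) ++ u        ≡⟨ cong (_++ u) (pow-comm uv t c) ⟩
    (pow uv c ++ pow uv t) ++ u        ≡⟨ ++-assoc (pow uv c) (pow uv t) u ⟩
    pow uv c ++ (pow uv t ++ u)        ∎
    where
    open ≡-Reasoning
    uv = u ++ v

  suffix-pow⇔ : ∀ {z x : List A} {i} → IsSuffix (pow z i) x → (∀ j → i < j → ¬ IsSuffix (pow z j) x) →
                ∀ c → IsSuffix (pow z c) x ⇔ c ≤ i
  suffix-pow⇔ {z} {x} {i} (y , y++zⁱ≡x) maximal c = mk⇔ (λ suffix → ≮⇒≥ (λ i<c → maximal c i<c suffix)) shorter
    where
    open ≡-Reasoning
    shorter : c ≤ i → IsSuffix (pow z c) x
    shorter c≤i with d , c+d≡i ← m≤n⇒∃[o]m+o≡n c≤i = y ++ pow z d , (begin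
      (y ++ pow z d) ++ pow z c  ≡⟨ ++-assoc y (pow z d) (pow z c) ⟩
      y ++ (pow z d ++ pow z c)  ≡⟨ cong (y ++_) (pow-comm z d c) ⟩
      y ++ (pow z c ++ pow z d)  ≡⟨ cong (y ++_) (pow-+ z c d) ⟨
      y ++ pow z (c + d)         ≡⟨ cong (λ n → y ++ pow z n) c+d≡i ⟩
      y ++ pow z i               ≡⟨ y++zⁱ≡x ⟩
      x                          ∎)

  prefix-pow⇔ : ∀ {z x : List A} {i} → IsPrefix (pow z i) x → (∀ j → i < j → ¬ IsPrefix (pow z j) x) →
                ∀ c → IsPrefix (pow z c) x ⇔ c ≤ i
  prefix-pow⇔ {z} {x} {i} (y , zⁱ++y≡x) maximal c = mk⇔ (λ prefix → ≮⇒≥ (λ i<c → maximal c i<c prefix)) shorter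
    where
    open ≡-Reasoning
    shorter : c ≤ i → IsPrefix (pow z c) x
    shorter c≤i with d , c+d≡i ← m≤n⇒∃[o]m+o≡n c≤i = pow z d ++ y , (begin
      pow z c ++ pow z d ++ y    ≡⟨ ++-assoc (pow z c) (pow z d) y ⟨
      (pow z c ++ pow z d) ++ y  ≡⟨ cong (_++ y) (pow-+ z c d) ⟨
      pow z (c + d) ++ y         ≡⟨ cong (λ n → pow z n ++ y) c+d≡i ⟩
      pow z i ++ y               ≡⟨ zⁱ++y≡x ⟩
      x                          ∎)

  -- IsPeriod r x unfolds to 0 < r × Repeats r x.
  Repeats : ℕ → List A → Set
  Repeats r x = ∀ j → j + r < length x → at x j ≡ at x (j + r)

  Matches : List A → List A → ℕ → Set
  Matches x w k = take (length x) (drop k w) ≡ x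

  matches-at : ∀ {x : List A} w k → Matches x w k → ∀ j → j < length x → at w (k + j) ≡ at x j
  matches-at {x} w k match j j<x = begin
    at w (k + j)                       ≡⟨ at-drop k w j ⟨
    at (drop k w) j                    ≡⟨ at-take (length x) (drop k w) j j<x ⟨
    at (take (length x) (drop k w)) j  ≡⟨ cong (λ s → at s j) match ⟩
    at x j                             ∎
    where open ≡-Reasoning

  -- The empty word matches at every position, even beyond the end of w.
  matches⇒fits : ∀ {x : List A} k w → 0 < length x → Matches x w k → k + length x ≤ length w
  matches⇒fits {x} zero    w       _   match =
    subst (_≤ length w) (trans (sym (length-take (length x) w)) (cong length match)) (m⊓n≤n _ _)
  matches⇒fits {x} (suc k) []      0<x match =
    contradiction (subst (λ s → 0 < length s) (trans (sym match) (take-[] (length x))) 0<x) n≮0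
  matches⇒fits     (suc k) (c ∷ w) 0<x match = s≤s (matches⇒fits k w 0<x match)

  matches⇒repeats : ∀ {x w : List A} {k e k′} → k + e ≡ k′ → Matches x w k → Matches x w k′ → Repeats e x
  matches⇒repeats {x} {w} {k} {e} {k′} k+e≡k′ match match′ j j+e<x = begin
    at x j             ≡⟨ matches-at w k′ match′ j (≤-trans (m≤m+n (suc j) e) j+e<x) ⟨
    at w (k′ + j)      ≡⟨ cong (at w) shift ⟩
    at w (k + (j + e)) ≡⟨ matches-at w k match (j + e) j+e<x ⟩
    at x (j + e)       ∎
    where
    open ≡-Reasoning
    shift : k′ + j ≡ k + (j + e)
    shift = begin
      k′ + j       ≡⟨ cong (_+ j) k+e≡k′ ⟨
      k + e + j    ≡⟨ +-assoc k e j ⟩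
      k + (e + j)  ≡⟨ cong (k +_) (+-comm e j) ⟩
      k + (j + e)  ∎

  shortestPeriod≤later-match : ∀ {g} {x w : List A} {k₁ k₂} → IsShortestPeriod g x → k₁ < k₂ →
    Matches x w k₁ → Matches x w k₂ → g ≤ k₂
  shortestPeriod≤later-match {x = x} {w} {k₁} {k₂} (_ , least) k₁<k₂ match₁ match₂ =
    ≤-trans (least (k₂ ∸ k₁) (m<n⇒0<n∸m k₁<k₂ ,
                              matches⇒repeats {x = x} {w = w} (m+[n∸m]≡n (<⇒≤ k₁<k₂)) match₁ match₂))
            (m∸n≤m k₂ k₁)

  repeats-difference : ∀ {x : List A} p d → Repeats p x → Repeats (p + d) x → p + (p + d) ≤ length x → Repeats d x
  repeats-difference {x} p d rep-p rep-p+d bound j j+d<x with p ≤? j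
  ... | yes p≤j with j₀ , refl ← m≤n⇒∃[o]m+o≡n p≤j = begin
    at x (p + j₀)        ≡⟨ cong (at x) (+-comm p j₀) ⟩
    at x (j₀ + p)        ≡⟨ rep-p j₀ (subst (_< length x) (+-comm p j₀) (≤-<-trans (m≤m+n (p + j₀) d) j+d<x)) ⟨
    at x j₀              ≡⟨ rep-p+d j₀ (subst (_< length x) (rearrange j₀) j+d<x) ⟩
    at x (j₀ + (p + d))  ≡⟨ cong (at x) (rearrange j₀) ⟨
    at x (p + j₀ + d)    ∎
    where
    open ≡-Reasoning
    rearrange : ∀ i → p + i + d ≡ i + (p + d)
    rearrange i = trans (cong (_+ d) (+-comm p i)) (+-assoc i p d)
  ... | no p≰j = begin
    at x j              ≡⟨ rep-p+d j far ⟩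
    at x (j + (p + d))  ≡⟨ cong (at x) rearrange ⟩
    at x (j + d + p)    ≡⟨ rep-p (j + d) (subst (_< length x) rearrange far) ⟨
    at x (j + d)        ∎
    where
    open ≡-Reasoning
    far : j + (p + d) < length x
    far = <-≤-trans (+-monoˡ-< (p + d) (≰⇒> p≰j)) bound
    rearrange : j + (p + d) ≡ j + d + p
    rearrange = trans (cong (j +_) (+-comm p d)) (sym (+-assoc j d p))

  shortestPeriod∣repeats : ∀ {g} {x : List A} → IsShortestPeriod g x → ∀ e → Repeats e x → e + g ≤ length x → g ∣ e
  shortestPeriod∣repeats {g} {x} ((0<g , rep-g) , least) = <-rec Divisible step
    where
    Divisible : ℕ → Set
    Divisible e = Repeats e x → e + g ≤ length x → g ∣ e
    step : ∀ e → (∀ {d} → d < e → Divisible d) → Divisible e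
    step zero    _   _     _     = g ∣0
    step (suc e) rec rep-e bound =
      subst (g ∣_) g+d≡e (∣m∣n⇒∣m+n ∣-refl (rec d<e rep-d (≤-trans (+-monoˡ-≤ g d≤e) bound)))
      where
      d = suc e ∸ g
      g+d≡e : g + d ≡ suc e
      g+d≡e = m+[n∸m]≡n (least (suc e) (z<s , rep-e))
      d≤e : d ≤ suc e
      d≤e = m∸n≤m (suc e) g
      d<e : d < suc e
      d<e = subst (d <_) g+d≡e (m<n+m d 0<g)
      rep-d : Repeats d x
      rep-d = repeats-difference {x} g d rep-g (subst (λ r → Repeats r x) (sym g+d≡e) rep-e)
                (subst (_≤ length x) (trans (+-comm (suc e) g) (cong (g +_) (sym g+d≡e))) bound)

  matches-middle : ∀ (y x z : List A) → Matches x (y ++ x ++ z) (length y)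
  matches-middle y x z = trans (cong (take (length x)) (drop-length-++ y (x ++ z))) (take-length-++ x z)

  matches-beyond-middle≤ : ∀ (y x z : List A) e → 0 < length x → Matches x (y ++ x ++ z) (length y + e) → e ≤ length z
  matches-beyond-middle≤ y x z e 0<x match = +-cancelˡ-≤ (length y) e (length z) (+-cancelʳ-≤ (length x) _ _ (begin
    length y + e + length x           ≤⟨ matches⇒fits (length y + e) (y ++ x ++ z) 0<x match ⟩
    length (y ++ x ++ z)              ≡⟨ trans (length-++ y) (cong (length y +_) (length-++ x)) ⟩
    length y + (length x + length z)  ≡⟨ cong (length y +_) (+-comm (length x) (length z)) ⟩
    length y + (length z + length x)  ≡⟨ +-assoc (length y) (length z) (length x) ⟨
    length y + length z + length x    ∎))
    where open ≤-Reasoning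

  matches-offset : ∀ {g} (y x z : List A) k → IsShortestPeriod g x →
    g ≤ length y → length z ≤ length y → length y + length y ≤ length x → Matches x (y ++ x ++ z) k →
    (∃[ c ] k + c * g ≡ length y) ⊎ (∃[ c ] k ≡ length y + c * g)
  matches-offset {g} y x z k shortest@((0<g , _) , _) g≤y z≤y 2y≤x match = Sum.map before after (≤-total k (length y))
    where
    before : k ≤ length y → ∃[ c ] k + c * g ≡ length y
    before k≤y with e , k+e≡y ← m≤n⇒∃[o]m+o≡n k≤y
      with divides c e≡cg ← shortestPeriod∣repeats {x = x} shortest e
                               (matches⇒repeats {x = x} {w = y ++ x ++ z} k+e≡y match (matches-middle y x z))
                               (≤-trans (+-mono-≤ (m+n≤o⇒n≤o k (≤-reflexive k+e≡y)) g≤y) 2y≤x)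
      = c , trans (cong (k +_) (sym e≡cg)) k+e≡y
    0<x : 0 < length x
    0<x = <-≤-trans 0<g (≤-trans g≤y (≤-trans (m≤m+n (length y) (length y)) 2y≤x))
    after : length y ≤ k → ∃[ c ] k ≡ length y + c * g
    after y≤k with e , refl ← m≤n⇒∃[o]m+o≡n y≤k
      with divides c e≡cg ← shortestPeriod∣repeats {x = x} shortest e
                               (matches⇒repeats {x = x} {w = y ++ x ++ z} {k = length y} refl (matches-middle y x z) match)
                               (≤-trans (+-mono-≤ (≤-trans (matches-beyond-middle≤ y x z e 0<x match) z≤y) g≤y) 2y≤x)
      = c , cong (length y +_) e≡cg

  module _ {x s s′ : List A} (x++s′≡s++x : x ++ s′ ≡ s ++ x) (s≤x : length s ≤ length x) where

    matches-left⇔ : ∀ (y z : List A) k → k + length s ≡ length y → Matches x (y ++ x ++ z) k ⇔ IsSuffix s y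
    matches-left⇔ y z k k+s≡y = mk⇔ to from
      where
      open ≡-Reasoning
      k≤y : k ≤ length y
      k≤y = subst (k ≤_) k+s≡y (m≤m+n k (length s))
      tail-length : length (drop k y) ≡ length s
      tail-length = trans (length-drop k y) (trans (cong (_∸ k) (sym k+s≡y)) (m+n∸m≡n k (length s)))
      to : Matches x (y ++ x ++ z) k → IsSuffix s y
      to match = take k y , trans (cong (take k y ++_) (sym tail≡s)) (take++drop≡id k y)
        where
        tail≡s : drop k y ≡ s
        tail≡s = begin
          drop k y                                                  ≡⟨ take-length-++ (drop k y) (x ++ z) ⟨
          take (length (drop k y)) (drop k y ++ x ++ z)             ≡⟨ cong (λ n → take n (drop k y ++ x ++ z)) tail-length ⟩
          take (length s) (drop k y ++ x ++ z)                      ≡⟨ take-prefix s≤x (drop k y ++ x ++ z) ⟨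
          take (length s) (take (length x) (drop k y ++ x ++ z))    ≡⟨ cong (take (length s) ∘ take (length x)) (drop-++ˡ k y (x ++ z) k≤y) ⟨
          take (length s) (take (length x) (drop k (y ++ x ++ z)))  ≡⟨ cong (take (length s)) match ⟩
          take (length s) x                                         ≡⟨ conjugate⇒take x++s′≡s++x s≤x ⟩
          s                                                         ∎
      from : IsSuffix s y → Matches x (y ++ x ++ z) k
      from (y₀ , refl) = begin
        take (length x) (drop k ((y₀ ++ s) ++ x ++ z))          ≡⟨ cong₂ (λ i w → take (length x) (drop i w)) k≡y₀ (++-assoc y₀ s (x ++ z)) ⟩
        take (length x) (drop (length y₀) (y₀ ++ s ++ x ++ z))  ≡⟨ cong (take (length x)) (drop-length-++ y₀ (s ++ x ++ z)) ⟩
        take (length x) (s ++ x ++ z)                           ≡⟨ cong (take (length x)) (++-assoc s x z) ⟨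
        take (length x) ((s ++ x) ++ z)                         ≡⟨ cong (λ w → take (length x) (w ++ z)) x++s′≡s++x ⟨
        take (length x) ((x ++ s′) ++ z)                        ≡⟨ cong (take (length x)) (++-assoc x s′ z) ⟩
        take (length x) (x ++ s′ ++ z)                          ≡⟨ take-length-++ x (s′ ++ z) ⟩
        x                                                       ∎
        where
        k≡y₀ : k ≡ length y₀
        k≡y₀ = +-cancelʳ-≡ (length s) k (length y₀) (trans k+s≡y (length-++ y₀))

    matches-right⇔ : ∀ (y z : List A) k → k ≡ length y + length s → Matches x (y ++ x ++ z) k ⇔ IsPrefix s′ z
    matches-right⇔ y z k k≡y+s = mk⇔ to from
      where
      open ≡-Reasoning
      shifted : ∀ w → drop k (y ++ x ++ w) ≡ drop (length s) (x ++ w)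
      shifted w = begin
        drop k (y ++ x ++ w)                             ≡⟨ cong (λ i → drop i (y ++ x ++ w)) k≡y+s ⟩
        drop (length y + length s) (y ++ x ++ w)         ≡⟨ drop-drop (length y) (length s) (y ++ x ++ w) ⟨
        drop (length s) (drop (length y) (y ++ x ++ w))  ≡⟨ cong (drop (length s)) (drop-length-++ y (x ++ w)) ⟩
        drop (length s) (x ++ w)                         ∎
      to : Matches x (y ++ x ++ z) k → IsPrefix s′ z
      to match = drop (length s) z , trans (cong (_++ drop (length s) z) (sym head≡s′)) (take++drop≡id (length s) z)
        where
        head≡s′ : take (length s) z ≡ s′
        head≡s′ = ++-cancelˡ x (take (length s) z) s′ (begin
          x ++ take (length s) z                        ≡⟨ take-length+-++ (length s) x z ⟨
          take (length x + length s) (x ++ z)           ≡⟨ cong (λ n → take n (x ++ z)) (+-comm (length x) (length s)) ⟩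
          take (length s + length x) (x ++ z)           ≡⟨ take-+ (length s) (length x) (x ++ z) ⟩
          take (length s) (x ++ z) ++ take (length x) (drop (length s) (x ++ z))
            ≡⟨ cong₂ _++_ (take-++ˡ (length s) x z s≤x) (trans (cong (take (length x)) (sym (shifted z))) match) ⟩
          take (length s) x ++ x                        ≡⟨ cong (_++ x) (conjugate⇒take x++s′≡s++x s≤x) ⟩
          s ++ x                                        ≡⟨ x++s′≡s++x ⟨
          x ++ s′                                       ∎)
      from : IsPrefix s′ z → Matches x (y ++ x ++ z) k
      from (r , refl) = begin
        take (length x) (drop k (y ++ x ++ s′ ++ r))        ≡⟨ cong (take (length x)) (shifted (s′ ++ r)) ⟩
        take (length x) (drop (length s) (x ++ s′ ++ r))    ≡⟨ cong (take (length x) ∘ drop (length s)) (++-assoc x s′ r) ⟨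
        take (length x) (drop (length s) ((x ++ s′) ++ r))  ≡⟨ cong (λ w → take (length x) (drop (length s) (w ++ r))) x++s′≡s++x ⟩
        take (length x) (drop (length s) ((s ++ x) ++ r))   ≡⟨ cong (take (length x) ∘ drop (length s)) (++-assoc s x r) ⟩
        take (length x) (drop (length s) (s ++ x ++ r))    ≡⟨ cong (take (length x)) (drop-length-++ s (x ++ r)) ⟩
        take (length x) (x ++ r)                            ≡⟨ take-length-++ x r ⟩
        x                                                   ∎

module _ {A : Set} {q′ q q″ u v : List A} {g t i′ i″ : ℕ}
  (shortest : IsShortestPeriod g q) (q≡ : q ≡ pow (u ++ v) t ++ u) (|uv|≡g : length (u ++ v) ≡ g)
  (g≤h : g ≤ length q′) (|q″|≡h : length q″ ≡ length q′) (2h≤L : length q′ + length q′ ≤ length q)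
  (suffix′ : IsSuffix (pow (u ++ v) i′) q′) (maximal′ : ∀ j → i′ < j → ¬ IsSuffix (pow (u ++ v) j) q′)
  (prefix″ : IsPrefix (pow (v ++ u) i″) q″) (maximal″ : ∀ j → i″ < j → ¬ IsPrefix (pow (v ++ u) j) q″)
  where

  private
    h = length q′
    W = q′ ++ q ++ q″

    0<g : 0 < g
    0<g = proj₁ (proj₁ shortest)

    h≤L : h ≤ length q
    h≤L = m+n≤o⇒n≤o h 2h≤L

    0<L : 0 < length q
    0<L = <-≤-trans 0<g (≤-trans g≤h h≤L)

    conjugate : ∀ c → q ++ pow (v ++ u) c ≡ pow (u ++ v) c ++ q
    conjugate c = subst (λ w → w ++ pow (v ++ u) c ≡ pow (u ++ v) c ++ w) (sym q≡) (pow-conjugate u v t c)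

    length-pow-uv : ∀ c → length (pow (u ++ v) c) ≡ c * g
    length-pow-uv c = trans (length-pow (u ++ v) c) (cong (c *_) |uv|≡g)

    matches-left⇔bounded : ∀ c k → k + c * g ≡ h → Matches q W k ⇔ c ≤ i′
    matches-left⇔bounded c k k+cg≡h =
      suffix-pow⇔ suffix′ maximal′ c ⇔-∘
      matches-left⇔ (conjugate c)
        (subst (_≤ length q) (sym (length-pow-uv c)) (≤-trans (m+n≤o⇒n≤o k (≤-reflexive k+cg≡h)) h≤L))
        q′ q″ k (trans (cong (k +_) (length-pow-uv c)) k+cg≡h)

    matches-right⇔bounded : ∀ c k → c * g ≤ length q → k ≡ h + c * g → Matches q W k ⇔ c ≤ i″
    matches-right⇔bounded c k cg≤L k≡h+cg =
      prefix-pow⇔ prefix″ maximal″ c ⇔-∘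
      matches-right⇔ (conjugate c) (subst (_≤ length q) (sym (length-pow-uv c)) cg≤L)
        q′ q″ k (trans k≡h+cg (cong (h +_) (sym (length-pow-uv c))))

    i″g≤h : i″ * g ≤ h
    i″g≤h = begin
      i″ * g                                     ≡⟨ cong (i″ *_) |vu|≡g ⟨
      i″ * length (v ++ u)                       ≡⟨ length-pow (v ++ u) i″ ⟨
      length (pow (v ++ u) i″)                   ≤⟨ m≤m+n _ _ ⟩
      length (pow (v ++ u) i″) + length (proj₁ prefix″) ≡⟨ length-++ (pow (v ++ u) i″) ⟨
      length (pow (v ++ u) i″ ++ proj₁ prefix″)  ≡⟨ cong length (proj₂ prefix″) ⟩
      length q″                                  ≡⟨ |q″|≡h ⟩
      h                                          ∎
      where
      open ≤-Reasoning
      |vu|≡g : length (v ++ u) ≡ g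
      |vu|≡g = trans (length-++ v) (trans (+-comm (length v) (length u)) (trans (sym (length-++ u)) |uv|≡g))

    matches⇔two-sided : ∀ k → Matches q W k ⇔ TwoSided g h i′ i″ k
    matches⇔two-sided k = mk⇔ to from
      where
      to : Matches q W k → TwoSided g h i′ i″ k
      to match with matches-offset q′ q q″ k shortest g≤h (≤-reflexive |q″|≡h) 2h≤L match
      ... | inj₁ (c , k+cg≡h) = inj₁ (c , Equivalence.to (matches-left⇔bounded c k k+cg≡h) match , k+cg≡h)
      ... | inj₂ (c , refl) = inj₂ (c , Equivalence.to (matches-right⇔bounded c _ cg≤L refl) match , refl)
        where
        cg≤L : c * g ≤ length q
        cg≤L = ≤-trans (matches-beyond-middle≤ q′ q q″ (c * g) 0<L match) (≤-trans (≤-reflexive |q″|≡h) h≤L)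
      from : TwoSided g h i′ i″ k → Matches q W k
      from (inj₁ (c , c≤i′ , k+cg≡h)) = Equivalence.from (matches-left⇔bounded c k k+cg≡h) c≤i′
      from (inj₂ (c , c≤i″ , k≡h+cg)) =
        Equivalence.from (matches-right⇔bounded c k (≤-trans (*-monoˡ-≤ g c≤i″) (≤-trans i″g≤h h≤L)) k≡h+cg) c≤i″

    -- The leftmost occurrence of q starts at a = h − i′ g.
    a = length (proj₁ suffix′)

    a+i′g≡h : a + i′ * g ≡ h
    a+i′g≡h = trans (cong (a +_) (sym (length-pow-uv i′)))
                    (trans (sym (length-++ (proj₁ suffix′))) (cong length (proj₂ suffix′)))

  countOcc-flanked : (_≟_ : DecidableEquality A) → countOcc _≟_ q W ≡ suc (i′ + i″)
  countOcc-flanked _≟_ =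
    length-filter-upTo-progression (λ k → ≡-dec _≟_ (take (length q) (drop k W)) q) a g (i′ + i″) (suc (length W))
      {{>-nonZero 0<g}} (λ k → two-sided⇔progression k a+i′g≡h ⇔-∘ matches⇔two-sided k) (s≤s last≤W)
    where
    open ≤-Reasoning
    last≤W : a + (i′ + i″) * g ≤ length W
    last≤W = begin
      a + (i′ + i″) * g           ≡⟨ cong (a +_) (*-distribʳ-+ g i′ i″) ⟩
      a + (i′ * g + i″ * g)       ≡⟨ +-assoc a (i′ * g) (i″ * g) ⟨
      a + i′ * g + i″ * g         ≡⟨ cong (_+ i″ * g) a+i′g≡h ⟩
      h + i″ * g                  ≤⟨ +-monoʳ-≤ h (≤-trans i″g≤h (m≤n+m h (length q))) ⟩
      h + (length q + h)          ≡⟨ cong (λ n → h + (length q + n)) |q″|≡h ⟨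
      h + (length q + length q″)  ≡⟨ trans (length-++ q′) (cong (h +_) (length-++ q)) ⟨
      length W                    ∎

third+third≤rest : ∀ m → m / 3 + m / 3 ≤ m ∸ m / 3
third+third≤rest m = m+n≤o⇒m≤o∸n (m / 3 + m / 3) (begin
  m / 3 + m / 3 + m / 3    ≡⟨ +-assoc (m / 3) (m / 3) (m / 3) ⟩
  m / 3 + (m / 3 + m / 3)  ≡⟨ cong (λ n → m / 3 + (m / 3 + n)) (+-identityʳ (m / 3)) ⟨
  3 * (m / 3)              ≡⟨ *-comm 3 (m / 3) ⟩
  m / 3 * 3                ≤⟨ m/n*n≤m m 3 ⟩
  m                        ∎)
  where open ≤-Reasoning

mainTheorem14 : {A : Set} (_≟_ : DecidableEquality A)
    (m : ℕ) (p W q′ q q″ : List A) →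
    length p ≡ m →
    W ≡ q′ ++ q ++ q″ →
    length q′ ≡ m / 3 → length q ≡ m ∸ m / 3 → length q″ ≡ m / 3 →
    (k₁ k₂ : ℕ) → k₁ < k₂ → OccursAt q p k₁ → OccursAt q p k₂ →
    (g : ℕ) → IsShortestPeriod g q →
    (u v : List A) (t : ℕ) →
    q ≡ pow (u ++ v) t ++ u → length (u ++ v) ≡ g → 1 ≤ length v → 2 ≤ t →
    (i′ : ℕ) → IsSuffix (pow (u ++ v) i′) q′ →
    (∀ j → i′ < j → ¬ IsSuffix (pow (u ++ v) j) q′) →
    (i″ : ℕ) → IsPrefix (pow (v ++ u) i″) q″ →
    (∀ j → i″ < j → ¬ IsPrefix (pow (v ++ u) j) q″) →
    countOcc _≟_ q W ≡ i′ + i″ + 1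
mainTheorem14 _≟_ m p W q′ q q″ refl refl |q′|≡h |q|≡L |q″|≡h k₁ k₂ k₁<k₂ (_ , match₁) (k₂+L≤m , match₂)
  g shortest u v t q≡ |uv|≡g _ _ i′ suffix′ maximal′ i″ prefix″ maximal″ =
  trans (countOcc-flanked {u = u} {v = v} {t = t} shortest q≡ |uv|≡g g≤h (trans |q″|≡h (sym |q′|≡h)) 2h≤L
           suffix′ maximal′ prefix″ maximal″ _≟_)
        (+-comm 1 (i′ + i″))
  where
  h = length p / 3
  2h≤L : length q′ + length q′ ≤ length q
  2h≤L = subst₂ (λ h′ L → h′ + h′ ≤ L) (sym |q′|≡h) (sym |q|≡L) (third+third≤rest (length p))
  k₂≤h : k₂ ≤ h
  k₂≤h = +-cancelʳ-≤ (length p ∸ h) k₂ h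
           (subst₂ (λ L n → k₂ + L ≤ n) |q|≡L (sym (m+[n∸m]≡n (m/n≤m (length p) 3))) k₂+L≤m)
  g≤h : g ≤ length q′
  g≤h = subst (g ≤_) (sym |q′|≡h) (≤-trans (shortestPeriod≤later-match shortest k₁<k₂ match₁ match₂) k₂≤h)
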